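{- If $f\in\mathsf{CTor}_2(\mathbb{Z}_2^n,\mathbb{Z}_2^m)$, then there is a map $g\in\mathsf{CNOT}(n,n+m)$ with $\tilde H_0(g)=\langle1,f\rangle$, where $\langle1,f\rangle:\mathbb{Z}_2^n\to\mathbb{Z}_2^{n+m}$ is the total map $x\mapsto(x,f(x))$.
   Context: $\mathbb{Z}_2^k$ is viewed as a torsor with $a\times_b c=a\oplus b\oplus c$; $\mathsf{CTor}_2(\mathbb{Z}_2^n,\mathbb{Z}_2^m)$ is the set of torsor homomorphisms, i.e. functions preserving this ternary operation (equivalently affine maps). $\mathsf{CNOT}$ is the strict symmetric monoidal category with objects the natural numbers ($n\otimes m=n+m$) generated by $\mathsf{cnot}:2\to2$, $|1\rangle:0\to1$, $\langle1|:1\to0$ (and symmetry $\sigma$) modulo the identities below (diagrammatic composition; $C_{i\to j}$ the cnot with control wire $i$, target wire $j$): $C_{1\to2}C_{2\to1}C_{1\to2}=\sigma$; $C_{1\to2}C_{1\to2}=1_2$; $C_{2\to1}C_{2\to3}=C_{2\to3}C_{2\to1}$; $(|1\rangle\otimes1)C_{1\to2}=(|1\rangle\otimes1)C_{1\to2}(\langle1|\otimes1)(|1\rangle\otimes1)$ and $C_{1\to2}(\langle1|\otimes1)=(\langle1|\otimes1)(|1\rangle\otimes1)C_{1\to2}(\langle1|\otimes1)$; $C_{1\to2}C_{3\to2}=C_{3\to2}C_{1\to2}$; $|1\rangle\langle1|=1_0$; $(|1\rangle\otimes|1\rangle\otimes1)C_{1\to2}C_{2\to3}(\langle1|\otimes1_2)=(|1\rangle\otimes|1\rangle\otimes1)C_{1\to2}(\langle1|\otimes1_2)$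 and $(|1\rangle\otimes1_2)C_{2\to3}C_{1\to2}(\langle1|\otimes\langle1|\otimes1)=(|1\rangle\otimes1_2)C_{1\to2}(\langle1|\otimes\langle1|\otimes1)$; $C_{1\to2}C_{2\to3}C_{1\to2}=C_{2\to3}C_{1\to3}$; $(|1\rangle\otimes|1\rangle\otimes1)C_{1\to2}(\langle1|\otimes\langle1|\otimes1)=(|1\rangle\otimes|1\rangle\otimes\langle1|)C_{1\to2}(\langle1|\otimes\langle1|\otimes|1\rangle)$. $\tilde H_0:\mathsf{CNOT}\to\mathsf{ParIso}(\mathsf{CTor}_2)^*$ (partial isomorphisms between nonempty finitely generated commutative characteristic-2 torsors) is the monoidal functor with $\tilde H_0(n)=\mathbb{Z}_2^n$, $\mathsf{cnot}\mapsto((x,y)\mapsto(x,x\oplus y))$, $\sigma\mapsto$ swap, $|1\rangle\mapsto$ the point $1\in\mathbb{Z}_2$, $\langle1|\mapsto$ the partial map $\mathbb{Z}_2\to\mathbb{Z}_2^0$ defined only at $1$. -}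

module Defs where

open import Data.Nat using (ℕ; zero; suc; _+_)
open import Data.Bool using (Bool; true; false; _xor_)
open import Data.Vec using (Vec; []; _∷_; _++_; splitAt; zipWith)
open import Data.Product using (_×_; _,_; Σ)
open import Data.Maybe using (Maybe; just; nothing; _>>=_)
open import Relation.Binary.PropositionalEquality using (_≡_)

-- ℤ₂^k is represented as Vec Bool k, with ⊕ = pointwise xor.
_⊕_ : ∀ {k} → Vec Bool k → Vec Bool k → Vec Bool k
_⊕_ = zipWith _xor_

-- Torsor homomorphisms ℤ₂^n → ℤ₂^m: functions preserving a ×_b c = a ⊕ b ⊕ c.
IsTorsorHom : ∀ {n m} → (Vec Bool n → Vec Bool m) → Set
IsTorsorHom f = ∀ a b c → f (a ⊕ (b ⊕ c)) ≡ f a ⊕ (f b ⊕ f c)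

-- Syntactic morphisms (circuits) of the strict symmetric monoidal category
-- CNOT, generated by cnot, |1⟩, ⟨1|, and the symmetry σ.  Every morphism of
-- CNOT (a quotient of these terms by the listed identities) is the class of
-- such a term.
data Circ : ℕ → ℕ → Set where
  idC   : ∀ n → Circ n n
  _⨾_   : ∀ {a b c} → Circ a b → Circ b c → Circ a c   -- diagrammatic composition
  _⊗_   : ∀ {a b c d} → Circ a b → Circ c d → Circ (a + c) (b + d)
  cnot  : Circ 2 2
  swap  : Circ 2 2
  ket1  : Circ 0 1
  bra1  : Circ 1 0

infixl 5 _⨾_
infixl 6 _⊗_

PMap : ℕ → ℕ → Set
PMap a b = Vec Bool a → Maybe (Vec Bool b)

tensorP : ∀ {a b c d} → PMap a b → PMap c d → PMap (a + c) (b + d)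
tensorP {a} f g v with splitAt a v
... | (x , y , _) = f x >>= λ x' → g y >>= λ y' → just (x' ++ y')

-- The monoidal functor H̃₀ : CNOT → ParIso(CTor₂)*, on representing terms.
H₀ : ∀ {a b} → Circ a b → PMap a b
H₀ (idC n) v = just v
H₀ (f ⨾ g) v = H₀ f v >>= H₀ g
H₀ (f ⊗ g) = tensorP (H₀ f) (H₀ g)
H₀ cnot (x ∷ y ∷ []) = just (x ∷ (x xor y) ∷ [])
H₀ swap (x ∷ y ∷ []) = just (y ∷ x ∷ [])
H₀ ket1 [] = just (true ∷ [])
H₀ bra1 (true ∷ []) = just []
H₀ bra1 (false ∷ []) = nothing

-- A torsor homomorphism f : ℤ₂^(1+k) → ℤ₂^m is affine, so
-- f (x ∷ xs) = f (0 ∷ xs) ⊕ x·d with d = f (1 ∷ 0) ⊕ f (0 ∷ 0).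
-- By induction on the number of inputs, the graph ⟨1, f⟩ is therefore computed
-- by first computing the graph of xs ↦ f (0 ∷ xs) on the remaining wires and then
-- xoring d onto the output wires under control of the first wire; the base case
-- n = 0 prepares the constant f [] from |1⟩ and |0⟩ = (|1⟩ ⊗ |1⟩) cnot (⟨1| ⊗ 1).
module Submission where

open import Defs
open import Data.Nat using (ℕ; _+_; zero; suc)
open import Data.Bool using (Bool; true; false; _xor_; _∧_; if_then_else_)
open import Data.Bool.Properties using (xor-assoc; xor-identityˡ)
open import Data.Vec using (Vec; _++_; []; _∷_; replicate)
open import Data.Vec.Properties using (zipWith-assoc; zipWith-identityˡ)
open import Data.Maybe using (just)
open import Data.Product using (Σ; _,_)
open import Relation.Binary.PropositionalEquality using (_≡_; refl; sym; trans; cong; module ≡-Reasoning)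

zeros : ∀ k → Vec Bool k
zeros k = replicate k false

xorIf : ∀ {m} → Bool → Vec Bool m → Vec Bool m → Vec Bool m
xorIf x d z = if x then d ⊕ z else z

⊕-identityˡ : ∀ {k} (v : Vec Bool k) → zeros k ⊕ v ≡ v
⊕-identityˡ = zipWith-identityˡ xor-identityˡ

⊕-assoc : ∀ {k} (u v w : Vec Bool k) → (u ⊕ v) ⊕ w ≡ u ⊕ (v ⊕ w)
⊕-assoc = zipWith-assoc xor-assoc

restrictHead : ∀ {k m} → (Vec Bool (suc k) → Vec Bool m) → Vec Bool k → Vec Bool m
restrictHead f xs = f (false ∷ xs)

restrictHead-isTorsorHom : ∀ {k m} (f : Vec Bool (suc k) → Vec Bool m) →
  IsTorsorHom f → IsTorsorHom (restrictHead f)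
restrictHead-isTorsorHom f hom a b c = hom (false ∷ a) (false ∷ b) (false ∷ c)

headSlope : ∀ {k m} → (Vec Bool (suc k) → Vec Bool m) → Vec Bool m
headSlope {k} f = f (true ∷ zeros k) ⊕ f (false ∷ zeros k)

isTorsorHom-affineInHead : ∀ {k m} (f : Vec Bool (suc k) → Vec Bool m) → IsTorsorHom f →
  ∀ x xs → f (x ∷ xs) ≡ xorIf x (headSlope f) (restrictHead f xs)
isTorsorHom-affineInHead f hom false xs = refl
isTorsorHom-affineInHead {k} f hom true xs = begin
  f (true ∷ xs)
    ≡⟨ cong (λ v → f (true ∷ v)) (sym (trans (⊕-identityˡ (zeros k ⊕ xs)) (⊕-identityˡ xs))) ⟩
  f ((true ∷ zeros k) ⊕ ((false ∷ zeros k) ⊕ (false ∷ xs)))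
    ≡⟨ hom (true ∷ zeros k) (false ∷ zeros k) (false ∷ xs) ⟩
  f (true ∷ zeros k) ⊕ (f (false ∷ zeros k) ⊕ f (false ∷ xs))
    ≡⟨ sym (⊕-assoc _ _ _) ⟩
  headSlope f ⊕ restrictHead f xs ∎
  where open ≡-Reasoning

prepareBit : Bool → Circ 0 1
prepareBit true = ket1
prepareBit false = (ket1 ⊗ ket1) ⨾ cnot ⨾ (bra1 ⊗ idC 1)

H₀-prepareBit : ∀ b → H₀ (prepareBit b) [] ≡ just (b ∷ [])
H₀-prepareBit true = refl
H₀-prepareBit false = refl

prepare : ∀ {m} → Vec Bool m → Circ 0 m
prepare [] = idC 0
prepare (b ∷ c) = prepareBit b ⊗ prepare c

H₀-prepare : ∀ {m} (c : Vec Bool m) → H₀ (prepare c) [] ≡ just c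
H₀-prepare [] = refl
H₀-prepare (b ∷ c) rewrite H₀-prepareBit b | H₀-prepare c = refl

cnotWhen : Bool → Circ 2 2
cnotWhen true = cnot
cnotWhen false = idC 2

H₀-cnotWhen : ∀ b x z → H₀ (cnotWhen b) (x ∷ z ∷ []) ≡ just (x ∷ ((x ∧ b) xor z) ∷ [])
H₀-cnotWhen true true z = refl
H₀-cnotWhen true false z = refl
H₀-cnotWhen false true z = refl
H₀-cnotWhen false false z = refl

controlledXor : ∀ {m} → Vec Bool m → Circ (suc m) (suc m)
controlledXor [] = idC 1
controlledXor {suc m} (b ∷ d) =
  (cnotWhen b ⊗ idC m) ⨾ (swap ⊗ idC m) ⨾ (idC 1 ⊗ controlledXor d) ⨾ (swap ⊗ idC m)

H₀-controlledXor : ∀ {m} (d : Vec Bool m) x z →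
  H₀ (controlledXor d) (x ∷ z) ≡ just (x ∷ xorIf x d z)
H₀-controlledXor [] true [] = refl
H₀-controlledXor [] false [] = refl
H₀-controlledXor (b ∷ d) x (z ∷ zs) rewrite H₀-cnotWhen b x z | H₀-controlledXor d x zs with x
... | true = refl
... | false = refl

controlledXorAcross : ∀ k {m} → Vec Bool m → Circ (suc (k + m)) (suc (k + m))
controlledXorAcross zero d = controlledXor d
controlledXorAcross (suc k) {m} d =
  (swap ⊗ idC (k + m)) ⨾ (idC 1 ⊗ controlledXorAcross k d) ⨾ (swap ⊗ idC (k + m))

H₀-controlledXorAcross : ∀ k {m} (d : Vec Bool m) x (xs : Vec Bool k) z →
  H₀ (controlledXorAcross k d) (x ∷ (xs ++ z)) ≡ just (x ∷ (xs ++ xorIf x d z))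
H₀-controlledXorAcross zero d x [] z = H₀-controlledXor d x z
H₀-controlledXorAcross (suc k) d x (y ∷ xs) z rewrite H₀-controlledXorAcross k d x xs z = refl

graphCircuit : ∀ n {m} → (Vec Bool n → Vec Bool m) → Circ n (n + m)
graphCircuit zero f = prepare (f [])
graphCircuit (suc k) f =
  (idC 1 ⊗ graphCircuit k (restrictHead f)) ⨾ controlledXorAcross k (headSlope f)

H₀-graphCircuit : ∀ n {m} (f : Vec Bool n → Vec Bool m) → IsTorsorHom f →
  ∀ x → H₀ (graphCircuit n f) x ≡ just (x ++ f x)
H₀-graphCircuit zero f hom [] = H₀-prepare (f [])
H₀-graphCircuit (suc k) f hom (x ∷ xs)
  rewrite H₀-graphCircuit k (restrictHead f) (restrictHead-isTorsorHom f hom) xs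
        | H₀-controlledXorAcross k (headSlope f) x xs (restrictHead f xs)
        | isTorsorHom-affineInHead f hom x xs
  = refl

mainTheorem13 : (n m : ℕ) (f : Vec Bool n → Vec Bool m) → IsTorsorHom f →
    Σ (Circ n (n + m)) (λ g → ∀ x → H₀ g x ≡ just (x ++ f x))
mainTheorem13 n m f hom = graphCircuit n f , H₀-graphCircuit n f hom
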